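{- For any integer $\gamma \geq 0$, and any $\mathsf{Zin}_\gamma$-algebra $\mathcal{Z}$, the binary operations $\prec_a$, $\succ_a$, $a \in [\gamma]$ defined for all elements $x$ and $y$ of $\mathcal{Z}$ by \begin{equation} x \prec_a y := x \mathbin{\sqcup\!\sqcup}_a y, \qquad a \in [\gamma], \end{equation} and \begin{equation} x \succ_a y := y \mathbin{\sqcup\!\sqcup}_a x, \qquad a \in [\gamma], \end{equation} endow $\mathcal{Z}$ with a $\gamma$-polydendriform algebra structure.
   Context: The ground field has characteristic zero, $[\gamma] = \{1, \dots, \gamma\}$, and $a \downarrow a'$ denotes $\min(a, a')$. A $\mathsf{Zin}_\gamma$-algebra is a vector space $\mathcal{Z}$ with binary operations $\mathbin{\sqcup\!\sqcup}_a$, $a \in [\gamma]$, satisfying for all $x, y, z \in \mathcal{Z}$ and $a, a' \in [\gamma]$: $(x \mathbin{\sqcup\!\sqcup}_{a'} y) \mathbin{\sqcup\!\sqcup}_a z = x \mathbin{\sqcup\!\sqcup}_{a \downarrow a'} (y \mathbin{\sqcup\!\sqcup}_a z) + x \mathbin{\sqcup\!\sqcup}_{a \downarrow a'} (z \mathbin{\sqcup\!\sqcup}_{a'} y)$. A $\gamma$-polydendriform algebra (in the presentation used here) is a vector space with binary operations $\prec_a$, $\succ_a$, $a \in [\gamma]$, satisfying for all $x, y, z$ and $a, a' \in [\gamma]$: $(x \succ_{a'} y) \prec_a z = x \succ_{a'} (y \prec_a z)$; $(x \prec_{a'} y) \prec_a z = x \prec_{a \downarrow a'} (y \prec_a z)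 + x \prec_{a \downarrow a'} (y \succ_{a'} z)$; $(x \prec_{a'} y) \succ_{a \downarrow a'} z + (x \succ_a y) \succ_{a \downarrow a'} z = x \succ_a (y \succ_{a'} z)$. -}

module Defs where

open import Level using (Level; _⊔_)
open import Data.Nat using (ℕ)
import Data.Nat as ℕ
open import Data.Fin using (Fin; zero; suc)
open import Data.Product using (Σ)
open import Relation.Nullary using (¬_)
open import Algebra.Bundles using (CommutativeRing; Semiring)
open import Algebra.Module.Bundles using (Module)
import Algebra.Definitions.RawSemiring as RawSemiringDefs

-- Minimum on Fin γ.  The set [γ] = {1,…,γ} is encoded as Fin γ (a ↦ a-1),
-- which preserves the order, so a ↓ a' = min(a, a').
_↓_ : ∀ {γ} → Fin γ → Fin γ → Fin γ
zero  ↓ _     = zero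
suc _ ↓ zero  = zero
suc a ↓ suc b = suc (a ↓ b)

record IsCharZeroField {c ℓ : Level} (K : CommutativeRing c ℓ) : Set (c ⊔ ℓ) where
  open CommutativeRing K
  open RawSemiringDefs (Semiring.rawSemiring semiring) using (_×_)
  field
    0≉1      : ¬ (0# ≈ 1#)
    inverse  : ∀ x → ¬ (x ≈ 0#) → Σ Carrier (λ y → (x * y) ≈ 1#)
    charZero : ∀ (n : ℕ) → ¬ ((ℕ.suc n × 1#) ≈ 0#)

module _ {c ℓ m ℓm : Level} {K : CommutativeRing c ℓ} (V : Module K m ℓm) where
  open CommutativeRing K using () renaming (Carrier to S)
  open Module V

  record IsBilinear (_∙_ : Carrierᴹ → Carrierᴹ → Carrierᴹ) : Set (c ⊔ m ⊔ ℓm) where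
    field
      cong    : ∀ {x x' y y'} → x ≈ᴹ x' → y ≈ᴹ y' → (x ∙ y) ≈ᴹ (x' ∙ y')
      +-left  : ∀ x x' y → ((x +ᴹ x') ∙ y) ≈ᴹ ((x ∙ y) +ᴹ (x' ∙ y))
      +-right : ∀ x y y' → (x ∙ (y +ᴹ y')) ≈ᴹ ((x ∙ y) +ᴹ (x ∙ y'))
      *-left  : ∀ (s : S) x y → ((s *ₗ x) ∙ y) ≈ᴹ (s *ₗ (x ∙ y))
      *-right : ∀ (s : S) x y → (x ∙ (s *ₗ y)) ≈ᴹ (s *ₗ (x ∙ y))

  record IsZinAlgebra (γ : ℕ) (⧢ : Fin γ → Carrierᴹ → Carrierᴹ → Carrierᴹ)
         : Set (c ⊔ m ⊔ ℓm) where
    field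
      bilinear : ∀ a → IsBilinear (⧢ a)
      relation : ∀ (a a' : Fin γ) x y z →
        ⧢ a (⧢ a' x y) z ≈ᴹ (⧢ (a ↓ a') x (⧢ a y z) +ᴹ ⧢ (a ↓ a') x (⧢ a' z y))

  record IsPolydendriformAlgebra (γ : ℕ) (≺ ≻ : Fin γ → Carrierᴹ → Carrierᴹ → Carrierᴹ)
         : Set (c ⊔ m ⊔ ℓm) where
    field
      ≺-bilinear : ∀ a → IsBilinear (≺ a)
      ≻-bilinear : ∀ a → IsBilinear (≻ a)
      relation₁ : ∀ (a a' : Fin γ) x y z →
        ≺ a (≻ a' x y) z ≈ᴹ ≻ a' x (≺ a y z)
      relation₂ : ∀ (a a' : Fin γ) x y z →
        ≺ a (≺ a' x y) z ≈ᴹ (≺ (a ↓ a') x (≺ a y z) +ᴹ ≺ (a ↓ a') x (≻ a' y z))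
      relation₃ : ∀ (a a' : Fin γ) x y z →
        (≻ (a ↓ a') (≺ a' x y) z +ᴹ ≻ (a ↓ a') (≻ a x y) z) ≈ᴹ ≻ a x (≻ a' y z)

-- Writing ≺ₐ for ⧢ₐ and ≻ₐ for its opposite, the second polydendriform relation is the
-- Zin relation itself and the third is the Zin relation read backwards.  The first says
-- that right multiplications by ⧢ₐ and ⧢ₐ' commute, which holds because the Zin relation
-- expands both sides into the same two terms, since a ↓ a' = a' ↓ a.  No hypothesis on the
-- ground field is needed.
module Submission where

open import Defs
open import Level using (Level)
open import Data.Nat using (ℕ)
open import Data.Fin using (Fin; zero; suc)
open import Function using (flip)
open import Algebra.Bundles using (CommutativeRing)
open import Algebra.Module.Bundles using (Module)
open import Relation.Binary.PropositionalEquality as ≡ using (_≡_; refl)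

↓-comm : ∀ {γ} (a b : Fin γ) → a ↓ b ≡ b ↓ a
↓-comm zero    zero    = refl
↓-comm zero    (suc b) = refl
↓-comm (suc a) zero    = refl
↓-comm (suc a) (suc b) = ≡.cong suc (↓-comm a b)

module _ {c ℓ m ℓm : Level} {K : CommutativeRing c ℓ} (V : Module K m ℓm) where
  open Module V

  flip-isBilinear : ∀ {_∙_ : Carrierᴹ → Carrierᴹ → Carrierᴹ} →
                    IsBilinear V _∙_ → IsBilinear V (flip _∙_)
  flip-isBilinear B = record
    { cong    = λ p q → cong q p
    ; +-left  = λ x x' y → +-right y x x'
    ; +-right = λ x y y' → +-left y y' x
    ; *-left  = λ s x y → *-right s y x
    ; *-right = λ s x y → *-left s y x
    }
    where open IsBilinear B

  module _ {γ : ℕ} {⧢ : Fin γ → Carrierᴹ → Carrierᴹ → Carrierᴹ}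
           (Z : IsZinAlgebra V γ ⧢) where
    open IsZinAlgebra Z

    ⧢-right-exchange : ∀ (a a' : Fin γ) x y z →
                       ⧢ a (⧢ a' x y) z ≈ᴹ ⧢ a' (⧢ a x z) y
    ⧢-right-exchange a a' x y z = begin
      ⧢ a (⧢ a' x y) z                                     ≈⟨ relation a a' x y z ⟩
      ⧢ (a ↓ a') x (⧢ a y z) +ᴹ ⧢ (a ↓ a') x (⧢ a' z y)     ≡⟨ ≡.cong (λ b → ⧢ b x (⧢ a y z) +ᴹ ⧢ b x (⧢ a' z y)) (↓-comm a a') ⟩
      ⧢ (a' ↓ a) x (⧢ a y z) +ᴹ ⧢ (a' ↓ a) x (⧢ a' z y)     ≈⟨ +ᴹ-comm _ _ ⟩
      ⧢ (a' ↓ a) x (⧢ a' z y) +ᴹ ⧢ (a' ↓ a) x (⧢ a y z)     ≈⟨ relation a' a x z y ⟨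
      ⧢ a' (⧢ a x z) y                                     ∎
      where open import Relation.Binary.Reasoning.Setoid ≈ᴹ-setoid

    ⧢-relation-swapped : ∀ (a a' : Fin γ) x y z →
                         (⧢ (a ↓ a') x (⧢ a' z y) +ᴹ ⧢ (a ↓ a') x (⧢ a y z)) ≈ᴹ ⧢ a (⧢ a' x y) z
    ⧢-relation-swapped a a' x y z = ≈ᴹ-trans (+ᴹ-comm _ _) (≈ᴹ-sym (relation a a' x y z))

proposition4p3p2 : {c ℓ m ℓm : Level} (K : CommutativeRing c ℓ) → IsCharZeroField K →
    (γ : ℕ) (V : Module K m ℓm) (⧢ : Fin γ → Module.Carrierᴹ V → Module.Carrierᴹ V → Module.Carrierᴹ V) →
    IsZinAlgebra V γ ⧢ →
    IsPolydendriformAlgebra V γ (λ a x y → ⧢ a x y) (λ a x y → ⧢ a y x)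
proposition4p3p2 K _ γ V ⧢ Z = record
  { ≺-bilinear = bilinear
  ; ≻-bilinear = λ a → flip-isBilinear V (bilinear a)
  ; relation₁  = λ a a' x y z → ⧢-right-exchange V Z a a' y x z
  ; relation₂  = relation
  ; relation₃  = λ a a' x y z → ⧢-relation-swapped V Z a a' z y x
  }
  where open IsZinAlgebra Z
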